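{- Let $D$ be a directed graph on $n$ vertices and $k$ a positive integer. For every pair of vertices $u,v\in V(D)$ let $\widehat{\mathcal{P}}^k_{uv}\subseteq\mathcal{P}^k_{uv}$ be a $k$-representative family for $\mathcal{P}^k_{uv}$ with respect to the uniform matroid $U_{n,2k}$ on $V(D)$. Then $D$ has a directed cycle of length at least $k$ if and only if there exist a pair of vertices $u,v\in V(D)$ and a set $X\in\widehat{\mathcal{P}}^k_{uv}$ such that $D$ has a directed cycle $C$ in which the vertices of $X$ form a consecutive segment (i.e., induce a directed path of $C$).
   Context: For $u,v\in V(D)$ and integer $i$, $\mathcal{P}^i_{uv}$ is the family of sets $X\subseteq V(D)$ with $u,v\in X$, $|X|=i$, such that there is a directed path from $u$ to $v$ in $D$ of length $i-1$ (number of arcs) all of whose vertices belong to $X$. The uniform matroid $U_{n,2k}$ on $V(D)$ has as independent sets all subsets of $V(D)$ of size at most $2k$. A subfamily $\widehat{\mathcal{S}}\subseteq\mathcal{S}$ is $q$-representative for $\mathcal{S}$ with respect to a matroid $(E,\mathcal{I})$ if for every $Y\subseteq E$ with $|Y|\le q$: if some $X\in\mathcal{S}$ has $X\cap Y=\emptyset$ and $X\cup Y\in\mathcal{I}$, then some $\widehat{X}\in\widehat{\mathcal{S}}$ has $\widehat{X}\cap Y=\emptyset$ and $\widehat{X}\cup Y\in\mathcal{I}$. -}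

module Defs where

open import Data.Nat using (ℕ; _≤_; _*_)
open import Data.Fin using (Fin)
open import Data.Fin.Subset using (Subset; ∣_∣; _∩_; _∪_) renaming (_∈_ to _∈ₛ_; ⊥ to ∅)
open import Data.List using (List; []; _∷_; _++_; length; head; last)
open import Data.List.Membership.Propositional renaming (_∈_ to _∈ₗ_)
open import Data.List.Relation.Unary.All using (All)
open import Data.List.Relation.Unary.Unique.Propositional using (Unique)
open import Data.Maybe using (just)
open import Data.Product using (_×_; ∃; ∃-syntax)
open import Data.Unit using (⊤)
open import Data.Empty using (⊥)
open import Relation.Binary.PropositionalEquality using (_≡_)
open import Function.Bundles using (_⇔_)
open import Relation.Nullary using (¬_)

Digraph : ℕ → Set₁
Digraph n = Fin n → Fin n → Set

Loopless : ∀ {n} → Digraph n → Set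
Loopless E = ∀ x → ¬ E x x

Walk : ∀ {n} → Digraph n → List (Fin n) → Set
Walk E []            = ⊤
Walk E (x ∷ [])      = ⊤
Walk E (x ∷ y ∷ xs)  = E x y × Walk E (y ∷ xs)

-- a directed path: distinct vertices, consecutive ones joined by arcs;
-- its length (number of arcs) is  length p - 1
IsPathFromTo : ∀ {n} → Digraph n → Fin n → Fin n → List (Fin n) → Set
IsPathFromTo E u v p = Walk E p × Unique p × head p ≡ just u × last p ≡ just v

-- a directed cycle given by its cyclic list of vertices c = x ∷ r:
-- distinct vertices, arcs between consecutive ones and from the last back to x.
-- Its length is length c.
IsCycle : ∀ {n} → Digraph n → List (Fin n) → Set
IsCycle E c = ∃[ x ] ∃[ r ] (c ≡ x ∷ r × Walk E (x ∷ r ++ x ∷ []) × Unique c)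

HasCycleOfLengthAtLeast : ∀ {n} → Digraph n → ℕ → Set
HasCycleOfLengthAtLeast E k = ∃[ c ] (IsCycle E c × k ≤ length c)

Family : ℕ → Set₁
Family n = Subset n → Set

_⊆F_ : ∀ {n} → Family n → Family n → Set
A ⊆F B = ∀ X → A X → B X

𝒫 : ∀ {n} → Digraph n → ℕ → Fin n → Fin n → Family n
𝒫 E i u v X = u ∈ₛ X × v ∈ₛ X × ∣ X ∣ ≡ i ×
  ∃[ p ] (IsPathFromTo E u v p × length p ≡ i × All (_∈ₛ X) p)

UniformIndep : ∀ {n} → ℕ → Subset n → Set
UniformIndep r Z = ∣ Z ∣ ≤ r

-- Ŝ is q-representative for S w.r.t. the matroid with independent sets Ind
-- (the inclusion Ŝ ⊆ S is stated separately)
IsRepresentative : ∀ {n} → (Subset n → Set) → ℕ → Family n → Family n → Set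
IsRepresentative {n} Ind q S Ŝ =
  ∀ (Y : Subset n) → ∣ Y ∣ ≤ q →
    ∃[ X ] (S X × X ∩ Y ≡ ∅ × Ind (X ∪ Y)) →
    ∃[ X̂ ] (Ŝ X̂ × X̂ ∩ Y ≡ ∅ × Ind (X̂ ∪ Y))

-- the vertices of X form a consecutive segment of the cycle c:
-- some rotation b ++ a of c = a ++ b starts with a segment s whose vertex set is X
IsConsecutiveSegment : ∀ {n} → Subset n → List (Fin n) → Set
IsConsecutiveSegment X c =
  ∃[ a ] ∃[ b ] ∃[ s ] ∃[ t ]
    (c ≡ a ++ b × b ++ a ≡ s ++ t × (∀ x → (x ∈ₛ X) ⇔ (x ∈ₗ s)))

module Submission where

-- (⇐) If X ∈ P̂ᵏ_uv ⊆ 𝒫ᵏ_uv is a consecutive segment of a cycle C, then C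
--     has at least |X| = k vertices (segment-card≤length).
-- (⇒) Take a cycle c with at least k vertices.  If no member of any P̂ᵏ_uv is
--     a segment of a cycle, we find a strictly shorter cycle that is still
--     long; descent on the length of c then finishes the proof.  Write
--     c = P ++ Q with P = x … v the first k vertices.  Let Y be the first k
--     vertices of Q; since |V(P) ∪ Y| ≤ 2k, representativity provides
--     X̂ ∈ P̂ᵏ_xv avoiding Y, and X̂ is the vertex set of an x–v path P̂ on
--     k vertices.  Rerouting c along P̂ (reroute) either gives the cycle
--     P̂ ++ Q, in which X̂ is a segment, or, when P̂ re-enters Q at a last
--     vertex z, the cycle z → v → … → z; it is shorter than c and, as z lies
--     beyond the first k vertices of Q, it still has at least k vertices.

open import Defs
open import Data.Nat using (ℕ; zero; suc; _+_; _*_; _⊓_; _≤_; _<_; z≤n; s≤s)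
open import Data.Nat.Properties
open import Data.Fin using (Fin) renaming (_≟_ to _≟ᶠ_)
open import Data.Fin.Subset
  using (Subset; ∣_∣; _∩_; _∪_; _-_; ⁅_⁆) renaming (_∈_ to _∈ₛ_; ⊥ to ∅)
open import Data.Fin.Subset.Properties
  using ( ∣⊥∣≡0; ∣⁅x⁆∣≡1; x∈⁅x⁆; x∈⁅y⁆⇒x≡y; x∈p∪q⁺; x∈p∪q⁻; ∉⊥; x∈p∩q⁺; x∈p∩q⁻
        ; Empty-unique; p⊆q⇒∣p∣≤∣q∣; x∈p∧x≢y⇒x∈p-y; x∈p⇒∣p-x∣<∣p∣ )
open import Data.Bool using (true; false)
open import Data.Vec using ([]; _∷_)
open import Data.List using (List; []; _∷_; _++_; length; last; take; [_])
open import Data.List.Properties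
  using (++-assoc; ++-identityʳ; length-++; length-++-comm; length-++-≤ˡ; length-++-≤ʳ; length-take)
open import Data.List.Membership.Propositional using (_∉_) renaming (_∈_ to _∈ₗ_)
open import Data.List.Membership.Propositional.Properties using (∈-++⁺ˡ; ∈-++⁺ʳ; ∈-∃++)
import Data.List.Membership.DecPropositional as DecMembership
open import Data.List.Relation.Unary.Any using (here; there)
open import Data.List.Relation.Unary.All as All using (All; []; _∷_)
open import Data.List.Relation.Unary.All.Properties using (¬Any⇒All¬; ++⁻ˡ)
open import Data.List.Relation.Unary.AllPairs using ([]; _∷_)
open import Data.List.Relation.Unary.Unique.Propositional using (Unique)
open import Data.List.Relation.Unary.Unique.Propositional.Properties
  using () renaming (++⁺ to unique-++⁺)
open import Data.List.Relation.Binary.Disjoint.Propositional using (Disjoint)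
open import Data.List.Relation.Binary.Sublist.Propositional using (lookup)
open import Data.List.Relation.Binary.Sublist.Propositional.Properties using (take-⊆)
open import Data.Maybe using (just)
open import Data.Product using (_×_; _,_; proj₁; proj₂; ∃-syntax)
open import Data.Sum using (_⊎_; inj₁; inj₂)
open import Data.Unit using (tt)
open import Data.Empty using (⊥; ⊥-elim)
open import Function using (_∘_)
open import Function.Bundles using (_⇔_; mk⇔; Equivalence)
open import Relation.Binary.PropositionalEquality
  using (_≡_; refl; sym; trans; cong; subst; module ≡-Reasoning)
open import Relation.Nullary using (¬_; yes; no)
open import Relation.Unary using (Decidable)

unique-++⁻ : ∀ {A : Set} (xs ys : List A) → Unique (xs ++ ys) →
  Unique xs × Unique ys × Disjoint xs ys
unique-++⁻ []       ys u = [] , u , λ { (() , _) }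
unique-++⁻ (x ∷ xs) ys (x∉ ∷ u) with unique-++⁻ xs ys u
... | uxs , uys , xs#ys = ++⁻ˡ xs x∉ ∷ uxs , uys , x∷xs#ys
  where
    x∷xs#ys : Disjoint (x ∷ xs) ys
    x∷xs#ys (here refl , x∈ys) = All.lookup x∉ (∈-++⁺ʳ xs x∈ys) refl
    x∷xs#ys (there v∈xs , v∈ys) = xs#ys (v∈xs , v∈ys)

-- Every list either avoids a decidable property, or splits at the last of
-- its elements having it.  Used to find where a path last enters a cycle.
split-at-last : ∀ {A : Set} {P : A → Set} → Decidable P → (xs : List A) →
  All (¬_ ∘ P) xs ⊎
  ∃[ α ] ∃[ z ] ∃[ β ] (xs ≡ α ++ z ∷ β × P z × All (¬_ ∘ P) β)
split-at-last P? [] = inj₁ []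
split-at-last P? (x ∷ xs) with split-at-last P? xs
... | inj₂ (α , z , β , refl , Pz , β¬P) = inj₂ (x ∷ α , z , β , refl , Pz , β¬P)
... | inj₁ xs¬P with P? x
...   | yes Px = inj₂ ([] , x , xs , refl , Px , xs¬P)
...   | no ¬Px = inj₁ (¬Px ∷ xs¬P)

split-at : ∀ {A : Set} j (xs : List A) → j ≤ length xs →
  ∃[ ys ] ∃[ zs ] (xs ≡ ys ++ zs × length ys ≡ j)
split-at zero    xs       _         = [] , xs , refl , refl
split-at (suc j) (x ∷ xs) (s≤s j≤) with split-at j xs j≤
... | ys , zs , refl , refl = x ∷ ys , zs , refl , refl

∉-take⇒≤ : ∀ {A : Set} j (γ : List A) z δ → z ∉ take j (γ ++ z ∷ δ) → j ≤ length γ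
∉-take⇒≤ zero    γ       z δ _   = z≤n
∉-take⇒≤ (suc j) []      z δ z∉ = ⊥-elim (z∉ (here refl))
∉-take⇒≤ (suc j) (g ∷ γ) z δ z∉ = s≤s (∉-take⇒≤ j γ z δ (z∉ ∘ there))

last-∈ : ∀ {A : Set} {v : A} xs → last xs ≡ just v → v ∈ₗ xs
last-∈ (x ∷ [])     refl = here refl
last-∈ (x ∷ y ∷ xs) eq   = there (last-∈ (y ∷ xs) eq)

last-++ : ∀ {A : Set} (xs : List A) y ys → last (xs ++ y ∷ ys) ≡ last (y ∷ ys)
last-++ []           y ys = refl
last-++ (x ∷ [])     y ys = refl
last-++ (x ∷ x′ ∷ xs) y ys = last-++ (x′ ∷ xs) y ys

last-∷ : ∀ {A : Set} (x : A) xs → ∃[ v ] last (x ∷ xs) ≡ just v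
last-∷ x []       = x , refl
last-∷ x (y ∷ xs) = last-∷ y xs

∣∪∣≤ : ∀ {n} (p q : Subset n) → ∣ p ∪ q ∣ ≤ ∣ p ∣ + ∣ q ∣
∣∪∣≤ []           []           = z≤n
∣∪∣≤ (true ∷ p)  (true ∷ q)  = s≤s (≤-trans (∣∪∣≤ p q) (+-monoʳ-≤ ∣ p ∣ (n≤1+n _)))
∣∪∣≤ (true ∷ p)  (false ∷ q) = s≤s (∣∪∣≤ p q)
∣∪∣≤ (false ∷ p) (true ∷ q)  = ≤-trans (s≤s (∣∪∣≤ p q)) (≤-reflexive (sym (+-suc _ _)))
∣∪∣≤ (false ∷ p) (false ∷ q) = ∣∪∣≤ p q

module _ {n : ℕ} where
  open DecMembership (_≟ᶠ_ {n}) using (_∈?_)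

  toSet : List (Fin n) → Subset n
  toSet []       = ∅
  toSet (x ∷ xs) = ⁅ x ⁆ ∪ toSet xs

  ∈toSet⁺ : ∀ {y} {xs} → y ∈ₗ xs → y ∈ₛ toSet xs
  ∈toSet⁺ {xs = x ∷ xs} (here refl) = x∈p∪q⁺ (inj₁ (x∈⁅x⁆ x))
  ∈toSet⁺ {xs = x ∷ xs} (there y∈) = x∈p∪q⁺ (inj₂ (∈toSet⁺ y∈))

  ∈toSet⁻ : ∀ {y} xs → y ∈ₛ toSet xs → y ∈ₗ xs
  ∈toSet⁻ []       y∈ = ⊥-elim (∉⊥ y∈)
  ∈toSet⁻ (x ∷ xs) y∈ with x∈p∪q⁻ ⁅ x ⁆ (toSet xs) y∈
  ... | inj₁ y∈⁅x⁆ = here (x∈⁅y⁆⇒x≡y x y∈⁅x⁆)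
  ... | inj₂ y∈xs  = there (∈toSet⁻ xs y∈xs)

  ∣toSet∣≤length : ∀ xs → ∣ toSet xs ∣ ≤ length xs
  ∣toSet∣≤length []       = ≤-reflexive (∣⊥∣≡0 n)
  ∣toSet∣≤length (x ∷ xs) = begin
    ∣ ⁅ x ⁆ ∪ toSet xs ∣      ≤⟨ ∣∪∣≤ ⁅ x ⁆ (toSet xs) ⟩
    ∣ ⁅ x ⁆ ∣ + ∣ toSet xs ∣  ≡⟨ cong (_+ ∣ toSet xs ∣) (∣⁅x⁆∣≡1 x) ⟩
    suc ∣ toSet xs ∣          ≤⟨ s≤s (∣toSet∣≤length xs) ⟩
    suc (length xs)           ∎
    where open ≤-Reasoning

  unique⊆⇒length≤ : ∀ {X : Subset n} xs → Unique xs → All (_∈ₛ X) xs → length xs ≤ ∣ X ∣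
  unique⊆⇒length≤ []       _          _           = z≤n
  unique⊆⇒length≤ {X} (x ∷ xs) (x∉ ∷ uxs) (x∈X ∷ xs⊆X) =
    ≤-trans (s≤s (unique⊆⇒length≤ xs uxs xs⊆X-x)) (x∈p⇒∣p-x∣<∣p∣ x∈X)
    where
      xs⊆X-x : All (_∈ₛ X - x) xs
      xs⊆X-x = All.zipWith (λ (y∈X , x≢y) → x∈p∧x≢y⇒x∈p-y y∈X (x≢y ∘ sym)) (xs⊆X , x∉)

  ∣toSet∣≡length : ∀ xs → Unique xs → ∣ toSet xs ∣ ≡ length xs
  ∣toSet∣≡length xs u =
    ≤-antisym (∣toSet∣≤length xs) (unique⊆⇒length≤ xs u (All.tabulate ∈toSet⁺))

  unique⊆⇒enumerates : ∀ {X : Subset n} xs → Unique xs → All (_∈ₛ X) xs → ∣ X ∣ ≤ length xs →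
    ∀ y → y ∈ₛ X → y ∈ₗ xs
  unique⊆⇒enumerates xs u xs⊆X ∣X∣≤ y y∈X with y ∈? xs
  ... | yes y∈xs = y∈xs
  ... | no  y∉xs = ⊥-elim (<-irrefl refl (≤-trans too-long ∣X∣≤))
    where
      too-long : suc (length xs) ≤ _
      too-long = unique⊆⇒length≤ (y ∷ xs) (¬Any⇒All¬ xs y∉xs ∷ u) (y∈X ∷ xs⊆X)

  disjoint⇒∩≡∅ : ∀ {X Y : Subset n} → (∀ {y} → y ∈ₛ X → y ∈ₛ Y → ⊥) → X ∩ Y ≡ ∅
  disjoint⇒∩≡∅ {X} {Y} X#Y = Empty-unique λ (y , y∈X∩Y) →
    let (y∈X , y∈Y) = x∈p∩q⁻ X Y y∈X∩Y in X#Y y∈X y∈Y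

  ∩≡∅⇒disjoint : ∀ {X Y : Subset n} → X ∩ Y ≡ ∅ → ∀ {y} → y ∈ₛ X → y ∈ₛ Y → ⊥
  ∩≡∅⇒disjoint X∩Y≡∅ y∈X y∈Y = ∉⊥ (subst (_ ∈ₛ_) X∩Y≡∅ (x∈p∩q⁺ (y∈X , y∈Y)))

segment-card≤length : ∀ {n} {X : Subset n} {C} → IsConsecutiveSegment X C → ∣ X ∣ ≤ length C
segment-card≤length {X = X} (a , b , s , t , refl , ba≡st , X⇔s) = begin
  ∣ X ∣                ≤⟨ p⊆q⇒∣p∣≤∣q∣ (λ y∈X → ∈toSet⁺ (Equivalence.to (X⇔s _) y∈X)) ⟩
  ∣ toSet s ∣          ≤⟨ ∣toSet∣≤length s ⟩
  length s             ≤⟨ m≤m+n _ _ ⟩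
  length s + length t  ≡⟨ sym (length-++ s) ⟩
  length (s ++ t)      ≡⟨ cong length (sym ba≡st) ⟩
  length (b ++ a)      ≡⟨ length-++-comm b a ⟩
  length (a ++ b)      ∎
  where open ≤-Reasoning

module _ {n : ℕ} (E : Digraph n) where
  open DecMembership (_≟ᶠ_ {n}) using (_∈?_)

  walk-++⁻ˡ : ∀ xs ys → Walk E (xs ++ ys) → Walk E xs
  walk-++⁻ˡ []           ys _       = tt
  walk-++⁻ˡ (x ∷ [])     ys _       = tt
  walk-++⁻ˡ (x ∷ y ∷ xs) ys (e , w) = e , walk-++⁻ˡ (y ∷ xs) ys w

  walk-++⁻ʳ : ∀ xs ys → Walk E (xs ++ ys) → Walk E ys
  walk-++⁻ʳ []           ys       w       = w
  walk-++⁻ʳ (x ∷ [])     []       _       = tt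
  walk-++⁻ʳ (x ∷ [])     (y ∷ ys) (_ , w) = w
  walk-++⁻ʳ (x ∷ y ∷ xs) ys       (_ , w) = walk-++⁻ʳ (y ∷ xs) ys w

  walk-after : ∀ {v} xs ys → Walk E (xs ++ ys) → last xs ≡ just v → Walk E (v ∷ ys)
  walk-after []           ys _       ()
  walk-after (x ∷ [])     ys w       refl = w
  walk-after (x ∷ y ∷ xs) ys (_ , w) eq   = walk-after (y ∷ xs) ys w eq

  walk-join : ∀ {v} xs ys → Walk E xs → last xs ≡ just v → Walk E (v ∷ ys) →
    Walk E (xs ++ ys)
  walk-join []           ys _       ()
  walk-join (x ∷ [])     ys _       refl w′ = w′
  walk-join (x ∷ y ∷ xs) ys (e , w) eq   w′ = e , walk-join (y ∷ xs) ys w eq w′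

  path-suffix : ∀ {u v} α z β → IsPathFromTo E u v (α ++ z ∷ β) → IsPathFromTo E z v (z ∷ β)
  path-suffix α z β (w , uniq , _ , lst) =
    walk-++⁻ʳ α (z ∷ β) w , proj₁ (proj₂ (unique-++⁻ α (z ∷ β) uniq)) , refl ,
    trans (sym (last-++ α z β)) lst

  close-cycle : ∀ {a v} l m → IsPathFromTo E a v (a ∷ l) → Walk E (v ∷ m ++ [ a ]) →
    Unique m → Disjoint (a ∷ l) m → IsCycle E (a ∷ l ++ m)
  close-cycle {a} l m (w , uniq , _ , lst) w′ uniq′ l#m =
    a , l ++ m , refl ,
    subst (λ t → Walk E (a ∷ t)) (sym (++-assoc l m [ a ]))
      (walk-join (a ∷ l) (m ++ [ a ]) w lst w′) ,
    unique-++⁺ uniq uniq′ l#m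

  open-cycle : ∀ x p q → IsCycle E (x ∷ p ++ q) →
    ∃[ v ] (IsPathFromTo E x v (x ∷ p) × Walk E (v ∷ q ++ [ x ]))
  open-cycle x p q (_ , _ , refl , w , uniq) with last-∷ x p
  ... | v , lst =
    v , (walk-++⁻ˡ (x ∷ p) (q ++ [ x ]) w′ , proj₁ (unique-++⁻ (x ∷ p) q uniq) , refl , lst) ,
    walk-after (x ∷ p) (q ++ [ x ]) w′ lst
    where
      w′ : Walk E (x ∷ p ++ q ++ [ x ])
      w′ = subst (λ t → Walk E (x ∷ t)) (++-assoc p q [ x ]) w

  path⇒𝒫 : ∀ {u v} p → IsPathFromTo E u v p → 𝒫 E (length p) u v (toSet p)
  path⇒𝒫 (x ∷ p) path@(_ , uniq , refl , lst) =
    ∈toSet⁺ {xs = x ∷ p} (here refl) , ∈toSet⁺ (last-∈ (x ∷ p) lst) ,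
    ∣toSet∣≡length (x ∷ p) uniq ,
    x ∷ p , path , refl , All.tabulate (∈toSet⁺ {xs = x ∷ p})

  𝒫⇒path : ∀ {i u v X} → 𝒫 E i u v X →
    ∃[ p ] (IsPathFromTo E u v p × length p ≡ i × (∀ y → y ∈ₛ X ⇔ y ∈ₗ p))
  𝒫⇒path (_ , _ , ∣X∣≡i , p , path@(_ , uniq , _ , _) , len , p⊆X) =
    p , path , len ,
    λ y → mk⇔ (unique⊆⇒enumerates p uniq p⊆X (≤-reflexive (trans ∣X∣≡i (sym len))) y)
              (All.lookup p⊆X)

  -- Either p closes up with q to a cycle, or the last
  -- vertex z of p lying on q gives a cycle z → v → (q up to z) with at least
  -- |p| vertices (z lies beyond the first |p| vertices of q) and fewer than
  -- |p| + |q| (it omits the first vertex of p and the vertex z of q).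
  reroute : ∀ {x v} p q → IsPathFromTo E x v p → Walk E (v ∷ q ++ [ x ]) →
    Unique q → x ∉ q → Disjoint p (take (length p) q) →
    IsCycle E (p ++ q) ⊎
    ∃[ c ] (IsCycle E c × length p ≤ length c × length c < length p + length q)
  reroute p q path w uq x∉q p#q₀ with split-at-last (_∈? q) p
  reroute (x ∷ p) q path@(_ , _ , refl , _) w uq _ _ | inj₁ p∉q =
    inj₁ (close-cycle p q path w uq (λ (y∈p , y∈q) → All.lookup p∉q y∈p y∈q))
  -- the last vertex of p on q cannot be the first vertex x, which is not on q
  reroute _ q (_ , _ , refl , _) _ _ x∉q _ | inj₂ ([] , z , β , refl , z∈q , _) =
    ⊥-elim (x∉q z∈q)
  reroute {x} {v} _ q path w uq _ p#q₀ | inj₂ (a ∷ α , z , β , refl , z∈q , β∉q)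
    with ∈-∃++ z∈q
  ... | γ , δ , refl =
    inj₂ (z ∷ β ++ γ , close-cycle β γ (path-suffix (a ∷ α) z β path) back uγ zβ#γ ,
          long , short)
    where
      back : Walk E (v ∷ γ ++ [ z ])
      back = walk-++⁻ˡ (v ∷ γ ++ [ z ]) (δ ++ [ x ])
        (subst (λ t → Walk E (v ∷ t))
          (trans (++-assoc γ (z ∷ δ) [ x ]) (sym (++-assoc γ [ z ] (δ ++ [ x ])))) w)
      uγ : Unique γ
      uγ = proj₁ (unique-++⁻ γ (z ∷ δ) uq)
      γ#zδ : Disjoint γ (z ∷ δ)
      γ#zδ = proj₂ (proj₂ (unique-++⁻ γ (z ∷ δ) uq))
      zβ#γ : Disjoint (z ∷ β) γ
      zβ#γ (here refl , z∈γ)  = γ#zδ (z∈γ , here refl)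
      zβ#γ (there y∈β , y∈γ) = All.lookup β∉q y∈β (∈-++⁺ˡ y∈γ)
      p : List (Fin n)
      p = a ∷ α ++ z ∷ β
      long : length p ≤ length (z ∷ β ++ γ)
      long = begin
        length p             ≤⟨ ∉-take⇒≤ (length p) γ z δ
                                   (λ z∈q₀ → p#q₀ (∈-++⁺ʳ (a ∷ α) (here refl) , z∈q₀)) ⟩
        length γ             ≤⟨ length-++-≤ʳ γ {z ∷ β} ⟩
        length (z ∷ β ++ γ)  ∎
        where open ≤-Reasoning
      short : length (z ∷ β ++ γ) < length p + length (γ ++ z ∷ δ)
      short = begin-strict
        length (z ∷ β ++ γ)           ≡⟨ length-++ (z ∷ β) ⟩
        length (z ∷ β) + length γ     <⟨ +-mono-<-≤ (s≤s (length-++-≤ʳ (z ∷ β) {α}))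
                                                    (length-++-≤ˡ γ) ⟩
        length p + length (γ ++ z ∷ δ) ∎
        where open ≤-Reasoning

descent : ∀ {A G : Set} (μ : A → ℕ) (P : A → Set) →
  (∀ a → P a → G ⊎ ∃[ b ] (P b × μ b < μ a)) → ∀ a → P a → G
descent {G = G} μ P step a Pa = go (suc (μ a)) a Pa ≤-refl
  where
    go : ∀ bound a → P a → μ a < bound → G
    go zero        a Pa ()
    go (suc bound) a Pa μa<bound with step a Pa
    ... | inj₁ g = g
    ... | inj₂ (b , Pb , μb<μa) = go bound b Pb (≤-trans μb<μa (≤-pred μa<bound))

module LongCycles {n : ℕ} (D : Digraph n) (k′ : ℕ) (P̂ : Fin n → Fin n → Family n)
  (P̂⊆𝒫 : ∀ u v → P̂ u v ⊆F 𝒫 D (suc k′) u v)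
  (P̂-rep : ∀ u v →
    IsRepresentative (UniformIndep (2 * suc k′)) (suc k′) (𝒫 D (suc k′) u v) (P̂ u v))
  where

  k : ℕ
  k = suc k′

  SegmentOfCycle : Set
  SegmentOfCycle =
    ∃[ u ] ∃[ v ] ∃[ X ] (P̂ u v X × ∃[ C ] (IsCycle D C × IsConsecutiveSegment X C))

  segment⇒long-cycle : SegmentOfCycle → HasCycleOfLengthAtLeast D k
  segment⇒long-cycle (u , v , X , X∈P̂ , C , cyc , seg) =
    C , cyc , subst (_≤ length C) ∣X∣≡k (segment-card≤length seg)
    where
      ∣X∣≡k : ∣ X ∣ ≡ k
      ∣X∣≡k = proj₁ (proj₂ (proj₂ (P̂⊆𝒫 u v X X∈P̂)))

  PathSetAvoiding : Fin n → Fin n → List (Fin n) → Subset n → Set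
  PathSetAvoiding x v ys X̂ = ∃[ p̂ ]
    (IsPathFromTo D x v p̂ × length p̂ ≡ k × (∀ y → y ∈ₛ X̂ ⇔ y ∈ₗ p̂) × Disjoint p̂ ys)

  -- The use of representativity: an x–v path on k vertices avoiding q is
  -- replaced by one whose vertex set lies in P̂ᵏ_xv and which avoids the first
  -- k vertices of q; the test set Y has at most k elements and together with
  -- the vertex set of the path at most 2k.
  representative-path : ∀ {x v} p q → IsPathFromTo D x v p → length p ≡ k → Disjoint p q →
    ∃[ X̂ ] (P̂ x v X̂ × PathSetAvoiding x v (take k q) X̂)
  representative-path {x} {v} p q path |p|≡k p#q =
    found (P̂-rep x v Y ∣Y∣≤k (toSet p , X∈𝒫 , X∩Y≡∅ , ∣X∪Y∣≤2k))
    where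
      Y : Subset n
      Y = toSet (take k q)
      ∣Y∣≤k : ∣ Y ∣ ≤ k
      ∣Y∣≤k = begin
        ∣ Y ∣                ≤⟨ ∣toSet∣≤length (take k q) ⟩
        length (take k q)    ≡⟨ length-take k q ⟩
        k ⊓ length q         ≤⟨ m⊓n≤m k (length q) ⟩
        k                    ∎
        where open ≤-Reasoning
      X∈𝒫 : 𝒫 D k x v (toSet p)
      X∈𝒫 = subst (λ i → 𝒫 D i x v (toSet p)) |p|≡k (path⇒𝒫 D p path)
      X∩Y≡∅ : toSet p ∩ Y ≡ ∅
      X∩Y≡∅ = disjoint⇒∩≡∅ λ y∈X y∈Y →
        p#q (∈toSet⁻ p y∈X , lookup (take-⊆ k q) (∈toSet⁻ (take k q) y∈Y))
      ∣X∪Y∣≤2k : ∣ toSet p ∪ Y ∣ ≤ 2 * k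
      ∣X∪Y∣≤2k = begin
        ∣ toSet p ∪ Y ∣      ≤⟨ ∣∪∣≤ (toSet p) Y ⟩
        ∣ toSet p ∣ + ∣ Y ∣  ≤⟨ +-mono-≤ (≤-trans (∣toSet∣≤length p) (≤-reflexive |p|≡k)) ∣Y∣≤k ⟩
        k + k                ≡⟨ cong (k +_) (sym (+-identityʳ k)) ⟩
        2 * k                ∎
        where open ≤-Reasoning
      found : ∃[ X̂ ] (P̂ x v X̂ × X̂ ∩ Y ≡ ∅ × UniformIndep (2 * k) (X̂ ∪ Y)) →
        ∃[ X̂ ] (P̂ x v X̂ × PathSetAvoiding x v (take k q) X̂)
      found (X̂ , X̂∈P̂ , X̂∩Y≡∅ , _) with 𝒫⇒path D (P̂⊆𝒫 x v X̂ X̂∈P̂)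
      ... | p̂ , patĥ , |p̂|≡k , X̂⇔p̂ =
        X̂ , X̂∈P̂ , p̂ , patĥ , |p̂|≡k , X̂⇔p̂ , λ (y∈p̂ , y∈q₀) →
          ∩≡∅⇒disjoint X̂∩Y≡∅ (Equivalence.from (X̂⇔p̂ _) y∈p̂) (∈toSet⁺ y∈q₀)

  long-cycle-step : ∀ c → IsCycle D c × k ≤ length c →
    SegmentOfCycle ⊎ ∃[ c′ ] ((IsCycle D c′ × k ≤ length c′) × length c′ < length c)
  long-cycle-step (x ∷ r) (cyc@(_ , _ , refl , _ , uc) , k≤) with split-at k′ r (≤-pred k≤)
  ... | p , q , refl , |p|≡k′ with open-cycle D x p q cyc | unique-++⁻ (x ∷ p) q uc
  ... | v , path , back | _ , uq , xp#q
    with representative-path (x ∷ p) q path (cong suc |p|≡k′) xp#q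
  ... | X̂ , X̂∈P̂ , p̂ , patĥ , |p̂|≡k , X̂⇔p̂ , p̂#q₀
    with reroute D p̂ q patĥ back uq (λ x∈q → xp#q (here refl , x∈q))
                 (subst (λ i → Disjoint p̂ (take i q)) (sym |p̂|≡k) p̂#q₀)
  ... | inj₁ cyc′ =
    inj₁ (x , v , X̂ , X̂∈P̂ , p̂ ++ q , cyc′ , X̂-is-first-segment)
    where
      X̂-is-first-segment : IsConsecutiveSegment X̂ (p̂ ++ q)
      X̂-is-first-segment = p̂ ++ q , [] , p̂ , q , sym (++-identityʳ _) , refl , X̂⇔p̂
  ... | inj₂ (c′ , cyc′ , |p̂|≤ , shorter) =
    inj₂ (c′ , (cyc′ , subst (_≤ length c′) |p̂|≡k |p̂|≤) ,
          subst (length c′ <_) same-length shorter)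
    where
      same-length : length p̂ + length q ≡ length (x ∷ p ++ q)
      same-length = begin
        length p̂ + length q        ≡⟨ cong (_+ length q) |p̂|≡k ⟩
        suc k′ + length q          ≡⟨ cong (λ i → suc i + length q) (sym |p|≡k′) ⟩
        suc (length p + length q)  ≡⟨ cong suc (sym (length-++ p)) ⟩
        length (x ∷ p ++ q)        ∎
        where open ≡-Reasoning

  long-cycle⇒segment : HasCycleOfLengthAtLeast D k → SegmentOfCycle
  long-cycle⇒segment (c , long) =
    descent length (λ c → IsCycle D c × k ≤ length c) long-cycle-step c long

lemma5p1 : ∀ (n : ℕ) (D : Digraph n) → Loopless D → (k : ℕ) → 0 < k →
    (P̂ : Fin n → Fin n → Family n) →
    (∀ u v → P̂ u v ⊆F 𝒫 D k u v) →
    (∀ u v → IsRepresentative (UniformIndep (2 * k)) k (𝒫 D k u v) (P̂ u v)) →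
    (HasCycleOfLengthAtLeast D k ⇔
    (∃[ u ] ∃[ v ] ∃[ X ] (P̂ u v X × ∃[ C ] (IsCycle D C × IsConsecutiveSegment X C))))
lemma5p1 _ _ _ zero ()
lemma5p1 _ D _ (suc k′) _ P̂ P̂⊆𝒫 P̂-rep =
  mk⇔ long-cycle⇒segment segment⇒long-cycle
  where open LongCycles D k′ P̂ P̂⊆𝒫 P̂-rep
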